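{- Let $x_1$ be an odd positive integer. The rational numbers whose odd greedy expansion has length $2$ and begins with denominator $x_1$ are exactly those of the form \[ \frac{(x_1^2+3)/2+2t}{(x_1^3+3x_1)/2-x_1^2+2x_1t}, \] where $t$ is any nonnegative integer.
   Context: Odd greedy expansion: given a positive rational $q$, define $x_1,x_2,\dots$ recursively: writing $R_i=q-\sum_{j=1}^{i-1}1/x_j$, if $R_i\ge1$ let $x_i=1$, and if $0<R_i<1$ let $x_i$ be the unique odd positive integer with $\frac1{x_i}\le R_i<\frac1{x_i-2}$; stop when the remainder is $0$. The $x_i$ are the denominators, and the number of terms is the length. -}

module Defs where

open import Data.Nat as ℕ using (ℕ; suc; _+_; _*_; _∸_; _^_; NonZero)
open import Data.Nat.DivMod using (_%_) renaming (_/_ to _div_)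
open import Data.Integer using (+_)
open import Data.Rational using (ℚ; 0ℚ; 1ℚ; _/_; _-_; _≤_; _<_)
open import Data.Product using (Σ; _×_)
open import Relation.Binary.PropositionalEquality using (_≡_)

recip : (n : ℕ) → .{{_ : NonZero n}} → ℚ
recip n = (+ 1) / n

Odd : ℕ → Set
Odd n = n % 2 ≡ 1

-- One step of the odd greedy algorithm:
-- Step R x R' : with current remainder R, the chosen denominator is x
-- and the next remainder is R' = R - 1/x.
--  * if R ≥ 1 then x = 1;
--  * if 0 < R < 1 then x is the odd positive integer with
--    1/x ≤ R < 1/(x-2).  (x = 1 is impossible here since 1/(1-2) < 0,
--    so x ≥ 3; we write x = 3 + k, so x - 2 = 1 + k.)
data Step : ℚ → ℕ → ℚ → Set where
  big   : ∀ {R} → 1ℚ ≤ R → Step R 1 (R - 1ℚ)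
  small : ∀ {R} (k : ℕ) → Odd (3 + k) → 0ℚ < R → R < 1ℚ →
          recip (3 + k) ≤ R → R < recip (1 + k) →
          Step R (3 + k) (R - recip (3 + k))

Len2From : ℚ → ℕ → Set
Len2From q x₁ =
  0ℚ < q × Σ ℚ (λ R₂ → Step q x₁ R₂ × 0ℚ < R₂ × Σ ℕ (λ x₂ → Step R₂ x₂ 0ℚ))

num : ℕ → ℕ → ℕ
num x t = ((x ^ 2 + 3) div 2) + 2 * t

den : ℕ → ℕ → ℕ
den x t = ((x ^ 3 + 3 * x) div 2) ∸ x ^ 2 + 2 * x * t

{-# OPTIONS --safe #-}
module Submission where

-- Write x₁ = 2m+1. A length-2 expansion starting at x₁ is q = 1/x₁ + 1/x₂ with x₂ = 2n+1 odd, and the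
-- only constraint is that the first step is greedy. For x₁ = 1 this is automatic; for x₁ = 2j+3 it says
-- q < 1/(2j+1), which after clearing denominators reads 4(j+1)² < 4n+3, i.e. n ≥ m². Setting n = m² + t,
-- the sum 1/x₁ + 1/x₂ = (x₁+x₂)/(x₁x₂) is the stated fraction.

open import Data.Nat as ℕ using (ℕ; zero; suc; _+_; _*_; _∸_; _^_; _≤_; _<_; z≤n; s≤s; NonZero)
open import Data.Nat.Properties as ℕ using ()
open import Data.Nat.DivMod using (m*n/n≡m; [m+kn]%n≡m%n; m≡m%n+[m/n]*n) renaming (_/_ to _div_)
open import Data.Nat.Tactic.RingSolver using (solve-∀)
open import Data.Integer as ℤ using (+_; +≤+; +<+)
open import Data.Integer.Properties as ℤ using ()
open import Data.Rational as ℚ using (ℚ; 0ℚ; 1ℚ; _/_; toℚᵘ; fromℚᵘ)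
open import Data.Rational.Properties as ℚ using ()
open import Data.Rational.Solver using (module +-*-Solver)
open import Data.Rational.Unnormalised as ℚᵘ using (mkℚᵘ; *≤*; *<*)
open import Data.Rational.Unnormalised.Properties as ℚᵘ using ()
open import Data.Product using (Σ; ∃-syntax; _×_; _,_)
open import Function.Bundles using (_⇔_; mk⇔; Equivalence)
import Function.Properties.Equivalence as ⇔
open import Relation.Binary.PropositionalEquality
open import Defs

toℚᵘ-/ : ∀ a b → toℚᵘ (+ a / suc b) ℚᵘ.≃ mkℚᵘ (+ a) b
toℚᵘ-/ a b = ℚ.toℚᵘ-fromℚᵘ (mkℚᵘ (+ a) b)

*≤*⇒/≤/ : ∀ {a b c d} → a * suc d ≤ c * suc b → + a / suc b ℚ.≤ + c / suc d
*≤*⇒/≤/ {a} {b} {c} {d} ad≤cb = ℚ.toℚᵘ-cancel-≤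
  (ℚᵘ.≤-respʳ-≃ (ℚᵘ.≃-sym (toℚᵘ-/ c d)) (ℚᵘ.≤-respˡ-≃ (ℚᵘ.≃-sym (toℚᵘ-/ a b))
    (*≤* (subst₂ ℤ._≤_ (ℤ.pos-* a (suc d)) (ℤ.pos-* c (suc b)) (+≤+ ad≤cb)))))

/</⇔*<* : ∀ {a b c d} → (+ a / suc b ℚ.< + c / suc d) ⇔ (a * suc d < c * suc b)
/</⇔*<* {a} {b} {c} {d} = mk⇔ to from
  where
  to : + a / suc b ℚ.< + c / suc d → a * suc d < c * suc b
  to ab<cd with ℚᵘ.<-respʳ-≃ (toℚᵘ-/ c d) (ℚᵘ.<-respˡ-≃ (toℚᵘ-/ a b) (ℚ.toℚᵘ-mono-< ab<cd))
  ... | *<* ad<cb = ℤ.drop‿+<+ (subst₂ ℤ._<_ (sym (ℤ.pos-* a (suc d))) (sym (ℤ.pos-* c (suc b))) ad<cb)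
  from : a * suc d < c * suc b → + a / suc b ℚ.< + c / suc d
  from ad<cb = ℚ.toℚᵘ-cancel-<
    (ℚᵘ.<-respʳ-≃ (ℚᵘ.≃-sym (toℚᵘ-/ c d)) (ℚᵘ.<-respˡ-≃ (ℚᵘ.≃-sym (toℚᵘ-/ a b))
      (*<* (subst₂ ℤ._<_ (ℤ.pos-* a (suc d)) (ℤ.pos-* c (suc b)) (+<+ ad<cb)))))

/+/≡ : ∀ a b c d → + a / suc b ℚ.+ + c / suc d ≡ + (a * suc d + c * suc b) / (suc b * suc d)
/+/≡ a b c d = begin
  x ℚ.+ y                                        ≡⟨ ℚ.fromℚᵘ-toℚᵘ (x ℚ.+ y) ⟨
  fromℚᵘ (toℚᵘ (x ℚ.+ y))                        ≡⟨ ℚ.fromℚᵘ-cong sum≃ ⟩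
  + (a * suc d + c * suc b) / (suc b * suc d)    ∎
  where
  open ≡-Reasoning
  x y : ℚ
  x = + a / suc b
  y = + c / suc d
  cross-sum≡ : + a ℤ.* + suc d ℤ.+ + c ℤ.* + suc b ≡ + (a * suc d + c * suc b)
  cross-sum≡ = trans (cong₂ ℤ._+_ (sym (ℤ.pos-* a (suc d))) (sym (ℤ.pos-* c (suc b))))
    (sym (ℤ.pos-+ (a * suc d) (c * suc b)))
  sum≃ : toℚᵘ (x ℚ.+ y) ℚᵘ.≃ mkℚᵘ (+ (a * suc d + c * suc b)) (ℕ.pred (suc b * suc d))
  sum≃ = ℚᵘ.≃-trans (ℚ.toℚᵘ-homo-+ x y) (ℚᵘ.≃-trans (ℚᵘ.+-cong (toℚᵘ-/ a b) (toℚᵘ-/ c d))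
    (ℚᵘ.≃-reflexive (cong (λ n → mkℚᵘ n _) cross-sum≡)))

recip-pos : ∀ a → 0ℚ ℚ.< recip (suc a)
recip-pos a = Equivalence.from (/</⇔*<* {0} {0} {1} {a}) (s≤s z≤n)

recip-antimono-< : ∀ {a b} → a < b → recip (suc b) ℚ.< recip (suc a)
recip-antimono-< {a} {b} a<b = Equivalence.from (/</⇔*<* {1} {b} {1} {a})
  (subst₂ _<_ (sym (ℕ.*-identityˡ (suc a))) (sym (ℕ.*-identityˡ (suc b))) (s≤s a<b))

recip-antimono-≤ : ∀ {a b} → a ≤ b → recip (suc b) ℚ.≤ recip (suc a)
recip-antimono-≤ {a} {b} a≤b = *≤*⇒/≤/ {1} {b} {1} {a}
  (subst₂ _≤_ (sym (ℕ.*-identityˡ (suc a))) (sym (ℕ.*-identityˡ (suc b))) (s≤s a≤b))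

recip+recip≡ : ∀ a b → recip (suc a) ℚ.+ recip (suc b) ≡ + (suc a + suc b) / (suc a * suc b)
recip+recip≡ a b = trans (/+/≡ 1 a 1 b) (ℚ./-cong (cong +_ (numerator a b)) refl)
  where
  numerator : ∀ a b → 1 * suc b + 1 * suc a ≡ suc a + suc b
  numerator = solve-∀

p≤p+q : ∀ {p q} → 0ℚ ℚ.≤ q → p ℚ.≤ p ℚ.+ q
p≤p+q {p} {q} 0≤q = subst (ℚ._≤ p ℚ.+ q) (ℚ.+-identityʳ p) (ℚ.+-monoʳ-≤ p 0≤q)

open +-*-Solver

p+[q-p]≡q : ∀ p q → p ℚ.+ (q ℚ.- p) ≡ q
p+[q-p]≡q = solve 2 (λ p q → p :+ (q :- p) := q) refl

[p+q]-p≡q : ∀ p q → (p ℚ.+ q) ℚ.- p ≡ q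
[p+q]-p≡q = solve 2 (λ p q → (p :+ q) :- p := q) refl

-- Written n * 2 rather than 2 * n so that oddRecip (suc j) and suc (suc j * 2) reduce to recip (3 + j * 2)
-- and 3 + j * 2, the shapes in which Step.small exposes its denominator.
oddRecip : ℕ → ℚ
oddRecip n = recip (suc (n * 2))

Odd-suc[m*2] : ∀ m → Odd (suc (m * 2))
Odd-suc[m*2] m = [m+kn]%n≡m%n 1 m 2

Odd⇒≡suc[m*2] : ∀ {x} → Odd x → ∃[ m ] x ≡ suc (m * 2)
Odd⇒≡suc[m*2] {x} x%2≡1 = x div 2 , trans (m≡m%n+[m/n]*n x 2) (cong (_+ x div 2 * 2) x%2≡1)

[2j+2n+4][2j+1]<[2j+3][2n+1]⇔[j+1]²≤n : ∀ j n →
  ((3 + j * 2) + suc (n * 2)) * suc (j * 2) < (3 + j * 2) * suc (n * 2) ⇔ suc j * suc j ≤ n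
[2j+2n+4][2j+1]<[2j+3][2n+1]⇔[j+1]²≤n j n = mk⇔ to from
  where
  lhs rhs s : ℕ
  lhs = ((3 + j * 2) + suc (n * 2)) * suc (j * 2)
  rhs = (3 + j * 2) * suc (n * 2)
  s = suc j * suc j
  -- rhs − lhs = (4n+3) − 4(j+1)².
  balance : ∀ j n → ((3 + j * 2) + suc (n * 2)) * suc (j * 2) + (3 + n * 4)
                  ≡ (3 + j * 2) * suc (n * 2) + suc j * suc j * 4
  balance = solve-∀
  to : lhs < rhs → s ≤ n
  to lhs<rhs = ℕ.≤-pred (ℕ.*-cancelʳ-< 4 s (suc n) (ℕ.<-≤-trans 4s<4n+3 (ℕ.n≤1+n _)))
    where
    4s<4n+3 : s * 4 < 3 + n * 4
    4s<4n+3 = ℕ.+-cancelˡ-< rhs (s * 4) (3 + n * 4)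
      (subst (_< rhs + (3 + n * 4)) (balance j n) (ℕ.+-monoˡ-< (3 + n * 4) lhs<rhs))
  from : s ≤ n → lhs < rhs
  from s≤n = ℕ.+-cancelʳ-< (3 + n * 4) lhs rhs (begin-strict
    lhs + (3 + n * 4)  ≡⟨ balance j n ⟩
    rhs + s * 4        ≤⟨ ℕ.+-monoʳ-≤ rhs (ℕ.*-monoˡ-≤ 4 s≤n) ⟩
    rhs + n * 4        <⟨ ℕ.+-monoʳ-< rhs (ℕ.m<n+m (n * 4) (s≤s z≤n)) ⟩
    rhs + (3 + n * 4)  ∎)
    where open ℕ.≤-Reasoning

1/[2j+3]+1/[2n+1]<1/[2j+1]⇔[j+1]²≤n : ∀ j n →
  oddRecip (suc j) ℚ.+ oddRecip n ℚ.< oddRecip j ⇔ suc j * suc j ≤ n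
1/[2j+3]+1/[2n+1]<1/[2j+1]⇔[j+1]²≤n j n =
  subst (λ p → p ℚ.< oddRecip j ⇔ suc j * suc j ≤ n) (sym (recip+recip≡ (suc j * 2) (n * 2)))
    (⇔.trans (/</⇔*<* {numerator} {ℕ.pred denominator} {1} {j * 2}) cross⇔)
  where
  numerator denominator : ℕ
  numerator = (3 + j * 2) + suc (n * 2)
  denominator = (3 + j * 2) * suc (n * 2)
  cross⇔ : numerator * suc (j * 2) < 1 * denominator ⇔ suc j * suc j ≤ n
  cross⇔ = subst (λ d → numerator * suc (j * 2) < d ⇔ suc j * suc j ≤ n) (sym (ℕ.*-identityˡ denominator))
    ([2j+2n+4][2j+1]<[2j+3][2n+1]⇔[j+1]²≤n j n)

Step-inversion : ∀ {R x R′} → Step R x R′ → ∃[ n ] (x ≡ suc (n * 2) × R ≡ oddRecip n ℚ.+ R′)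
Step-inversion {R} (big _) = 0 , refl , sym (p+[q-p]≡q 1ℚ R)
Step-inversion {R} (small k 3+k-odd _ _ _ _) with Odd⇒≡suc[m*2] 3+k-odd
... | n , 3+k≡ = n , 3+k≡ ,
  subst (λ y → R ≡ recip (suc y) ℚ.+ (R ℚ.- recip (3 + k))) (ℕ.suc-injective 3+k≡)
    (sym (p+[q-p]≡q (recip (3 + k)) R))

Step-square-bound : ∀ m {n q R′} → Step q (suc (m * 2)) R′ →
  q ≡ oddRecip m ℚ.+ oddRecip n → m * m ≤ n
Step-square-bound zero _ _ = z≤n
Step-square-bound (suc j) {n} (small _ _ _ _ _ q<1/[2j+1]) refl =
  Equivalence.to (1/[2j+3]+1/[2n+1]<1/[2j+1]⇔[j+1]²≤n j n) q<1/[2j+1]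

Step-recip : ∀ y → Odd (suc y) → Step (recip (suc y)) (suc y) 0ℚ
Step-recip zero _ = subst (Step 1ℚ 1) (ℚ.+-inverseʳ 1ℚ) (big ℚ.≤-refl)
Step-recip (suc (suc k)) 3+k-odd = subst (Step (recip (3 + k)) (3 + k)) (ℚ.+-inverseʳ (recip (3 + k)))
  (small k 3+k-odd (recip-pos (2 + k)) (recip-antimono-< {0} {2 + k} (s≤s z≤n)) ℚ.≤-refl
    (recip-antimono-< (ℕ.m≤n⇒m≤1+n (ℕ.n<1+n k))))

Step-greedy : ∀ m {n} → m * m ≤ n → Step (oddRecip m ℚ.+ oddRecip n) (suc (m * 2)) (oddRecip n)
Step-greedy zero {n} _ = subst (Step (1ℚ ℚ.+ oddRecip n) 1) ([p+q]-p≡q 1ℚ (oddRecip n))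
  (big (p≤p+q (ℚ.<⇒≤ (recip-pos (n * 2)))))
Step-greedy (suc j) {n} [j+1]²≤n = subst (Step q (3 + j * 2)) ([p+q]-p≡q (oddRecip (suc j)) (oddRecip n))
  (small (j * 2) (Odd-suc[m*2] (suc j)) 0<q (ℚ.<-≤-trans q<1/[2j+1] (recip-antimono-≤ {0} {j * 2} z≤n))
    (p≤p+q (ℚ.<⇒≤ (recip-pos (n * 2)))) q<1/[2j+1])
  where
  q : ℚ
  q = oddRecip (suc j) ℚ.+ oddRecip n
  0<q : 0ℚ ℚ.< q
  0<q = ℚ.+-mono-< (recip-pos (suc j * 2)) (recip-pos (n * 2))
  q<1/[2j+1] : q ℚ.< oddRecip j
  q<1/[2j+1] = Equivalence.from (1/[2j+3]+1/[2n+1]<1/[2j+1]⇔[j+1]²≤n j n) [j+1]²≤n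

GreedyOddRecipSum : ℕ → ℚ → Set
GreedyOddRecipSum m q = ∃[ n ] (m * m ≤ n × q ≡ oddRecip m ℚ.+ oddRecip n)

Len2From⇔ : ∀ m q → Len2From q (suc (m * 2)) ⇔ GreedyOddRecipSum m q
Len2From⇔ m q = mk⇔ to from
  where
  to : Len2From q (suc (m * 2)) → GreedyOddRecipSum m q
  to (_ , R₂ , step₁ , _ , _ , step₂) with Step-inversion step₁ | Step-inversion step₂
  ... | m′ , x₁≡ , q≡ | n , _ , R₂≡ =
    n , Step-square-bound m step₁ q≡1/x₁+1/x₂ , q≡1/x₁+1/x₂
    where
    q≡1/x₁+1/x₂ : q ≡ oddRecip m ℚ.+ oddRecip n
    q≡1/x₁+1/x₂ = begin
      q                           ≡⟨ q≡ ⟩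
      oddRecip m′ ℚ.+ R₂          ≡⟨ cong₂ (λ k r → oddRecip k ℚ.+ r) m′≡m R₂≡ ⟩
      oddRecip m ℚ.+ (oddRecip n ℚ.+ 0ℚ) ≡⟨ cong (oddRecip m ℚ.+_) (ℚ.+-identityʳ (oddRecip n)) ⟩
      oddRecip m ℚ.+ oddRecip n   ∎
      where
      open ≡-Reasoning
      m′≡m : m′ ≡ m
      m′≡m = ℕ.*-cancelʳ-≡ m′ m 2 (ℕ.suc-injective (sym x₁≡))
  from : GreedyOddRecipSum m q → Len2From q (suc (m * 2))
  from (n , m²≤n , refl) = ℚ.+-mono-< (recip-pos (m * 2)) (recip-pos (n * 2)) ,
    oddRecip n , Step-greedy m m²≤n , recip-pos (n * 2) , suc (n * 2) , Step-recip (n * 2) (Odd-suc[m*2] n)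

num-odd : ∀ m t → num (suc (m * 2)) t ≡ suc (m * 2) + suc ((m * m + t) * 2)
num-odd m t = begin
  (x ^ 2 + 3) div 2 + 2 * t            ≡⟨ cong (λ z → z div 2 + 2 * t) (x²+3 m) ⟩
  (x + y₀) * 2 div 2 + 2 * t           ≡⟨ cong (_+ 2 * t) (m*n/n≡m (x + y₀) 2) ⟩
  x + y₀ + 2 * t                       ≡⟨ regroup m t ⟩
  x + suc ((m * m + t) * 2)            ∎
  where
  open ≡-Reasoning
  x y₀ : ℕ
  x = suc (m * 2)
  y₀ = suc (m * m * 2)
  -- The ring solver does not handle _^_, so x ^ 2 and x ^ 3 appear unfolded in these identities.
  x²+3 : ∀ m → suc (m * 2) * (suc (m * 2) * 1) + 3 ≡ (suc (m * 2) + suc (m * m * 2)) * 2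
  x²+3 = solve-∀
  regroup : ∀ m t → suc (m * 2) + suc (m * m * 2) + 2 * t ≡ suc (m * 2) + suc ((m * m + t) * 2)
  regroup = solve-∀

den-odd : ∀ m t → den (suc (m * 2)) t ≡ suc (m * 2) * suc ((m * m + t) * 2)
den-odd m t = begin
  (x ^ 3 + 3 * x) div 2 ∸ x ^ 2 + 2 * x * t
    ≡⟨ cong (λ z → z div 2 ∸ x ^ 2 + 2 * x * t) (x³+3x m) ⟩
  (x ^ 2 + x * y₀) * 2 div 2 ∸ x ^ 2 + 2 * x * t
    ≡⟨ cong (λ z → z ∸ x ^ 2 + 2 * x * t) (m*n/n≡m (x ^ 2 + x * y₀) 2) ⟩
  x ^ 2 + x * y₀ ∸ x ^ 2 + 2 * x * t
    ≡⟨ cong (_+ 2 * x * t) (ℕ.m+n∸m≡n (x ^ 2) (x * y₀)) ⟩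
  x * y₀ + 2 * x * t
    ≡⟨ regroup m t ⟩
  x * suc ((m * m + t) * 2)
    ∎
  where
  open ≡-Reasoning
  x y₀ : ℕ
  x = suc (m * 2)
  y₀ = suc (m * m * 2)
  x³+3x : ∀ m → suc (m * 2) * (suc (m * 2) * (suc (m * 2) * 1)) + 3 * suc (m * 2)
        ≡ (suc (m * 2) * (suc (m * 2) * 1) + suc (m * 2) * suc (m * m * 2)) * 2
  x³+3x = solve-∀
  regroup : ∀ m t → suc (m * 2) * suc (m * m * 2) + 2 * suc (m * 2) * t ≡ suc (m * 2) * suc ((m * m + t) * 2)
  regroup = solve-∀

den-odd-nonZero : ∀ m t → NonZero (den (suc (m * 2)) t)
den-odd-nonZero m t = subst NonZero (sym (den-odd m t)) _

oddRecip+oddRecip≡num/den : ∀ m t .{{_ : NonZero (den (suc (m * 2)) t)}} →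
  oddRecip m ℚ.+ oddRecip (m * m + t) ≡ + num (suc (m * 2)) t / den (suc (m * 2)) t
oddRecip+oddRecip≡num/den m t =
  trans (recip+recip≡ (m * 2) ((m * m + t) * 2)) (ℚ./-cong (cong +_ (sym (num-odd m t))) (sym (den-odd m t)))

corollary3p3 : (x₁ : ℕ) → Odd x₁ → (q : ℚ) →
    Len2From q x₁ ⇔ Σ ℕ (λ t → Σ (NonZero (den x₁ t)) (λ nz → q ≡ _/_ (+ num x₁ t) (den x₁ t) {{nz}}))
corollary3p3 x₁ x₁-odd q with Odd⇒≡suc[m*2] {x₁} x₁-odd
... | m , refl = ⇔.trans (Len2From⇔ m q) (mk⇔ to from)
  where
  Parametrised : Set
  Parametrised = Σ ℕ (λ t → Σ (NonZero (den x₁ t)) (λ nz → q ≡ _/_ (+ num x₁ t) (den x₁ t) {{nz}}))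
  to : GreedyOddRecipSum m q → Parametrised
  to (n , m²≤n , q≡) = t , den-odd-nonZero m t ,
    trans q≡ (trans (cong (λ k → oddRecip m ℚ.+ oddRecip k) (sym (ℕ.m+[n∸m]≡n m²≤n)))
      (oddRecip+oddRecip≡num/den m t {{den-odd-nonZero m t}}))
    where
    t : ℕ
    t = n ∸ m * m
  from : Parametrised → GreedyOddRecipSum m q
  from (t , nz , q≡) =
    m * m + t , ℕ.m≤m+n (m * m) t , trans q≡ (sym (oddRecip+oddRecip≡num/den m t {{nz}}))
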